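{- For every non-negative integer $n$, the number of product-coproduct prographs with $n$ coproducts and $n$ products equals the $n$-th $3$-dimensional Catalan number, i.e. $|PC(n)| = |ST_{\langle n^3\rangle}| = \dfrac{2\,(3n)!}{n!\,(n+1)!\,(n+2)!}$.
   Context: A product-coproduct prograph is a finite connected planar directed graph, drawn in a horizontal strip with all edges oriented upward, whose nodes are of two kinds: coproducts (one input edge entering from below and two output edges leaving upward, distinguished as left and right) and products (two input edges entering from below, distinguished as left and right, and one output edge leaving upward). There is moreover exactly one global input edge entering from the bottom boundary of the strip and exactly one global output edge leaving through the top boundary; every other edge joins an output of one node to an input of another node. Prographs are considered up to planar isotopy (equivalently, they are the elements with one input and one output of the free PRO generated by one operator with one input and two outputs and one operator with two inputs and one output). Such a prograph necessarily has as many products as coproducts; $PC(n)$ denotes the set of those with $n$ coproducts and $n$ products ($PC(0)$ consists of the single edge). The $n$-th $3$-dimensional Catalan number is the number of lattice paths from $(0,0,0)$ to $(n,n,n)$ with steps $(1,0,0),(0,1,0),(0,0,1)$ all of whose points $(x,y,z)$ satisfy $x\ge y\ge z$; it equals the number $|ST_{\langle n^3\rangle}|$ of standard Young tableaux of rectangular shape $(n,n,n)$ (three rows of length $n$). -}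

module Defs where

open import Data.Nat using (ℕ; zero; suc; _+_; _*_; _∸_; _≤_; NonZero; _!)
open import Data.Nat.Properties using (m*n≢0; _!≢0)
open import Data.Nat.DivMod using (_/_)
open import Data.List using (List; []; _∷_; _++_)
open import Data.Product using (_×_; _,_)
open import Relation.Binary.PropositionalEquality using (_≡_)
open import Relation.Binary.Bundles using (Setoid)
open import Relation.Binary.Construct.Closure.Equivalence using (EqClosure; isEquivalence)
import Relation.Binary.Construct.On as On

-- Prographs as morphisms 1 → 1 of the free PRO on
--   cop : 1 → 2  (coproduct)   and   prod : 2 → 1  (product).
-- A morphism of the free PRO is a sequence of elementary layers
-- id_a ⊗ g ⊗ id_b (listed bottom to top), modulo the interchange law.

data Kind : Set where
  cop prod : Kind

ins : Kind → ℕ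
ins cop  = 1
ins prod = 2

outs : Kind → ℕ
outs cop  = 2
outs prod = 1

-- a node: its kind and the number a of wires strictly to its left
Node : Set
Node = Kind × ℕ

data WF : ℕ → List Node → ℕ → Set where
  done : ∀ {w} → WF w [] w
  step : ∀ {w w' k a ns} → a + ins k ≤ w →
         WF (w ∸ ins k + outs k) ns w' → WF w ((k , a) ∷ ns) w'

countCop : List Node → ℕ
countCop [] = 0
countCop ((cop , _) ∷ ns) = suc (countCop ns)
countCop ((prod , _) ∷ ns) = countCop ns

countProd : List Node → ℕ
countProd [] = 0
countProd ((cop , _) ∷ ns) = countProd ns
countProd ((prod , _) ∷ ns) = suc (countProd ns)

-- Interchange law: node g at position a followed by node h at position a'
-- lying entirely to the right of the outputs of g may be slid below g.
-- (The mirror case, h to the left, is the inverse of this move.)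
data Swap : List Node → List Node → Set where
  swap : ∀ xs ys g a h a' → a + outs g ≤ a' →
         Swap (xs ++ (g , a) ∷ (h , a') ∷ ys)
              (xs ++ (h , a' ∸ outs g + ins g) ∷ (g , a) ∷ ys)

record Prograph (n : ℕ) : Set where
  constructor prograph
  field
    nodes  : List Node
    wf     : WF 1 nodes 1
    #cop   : countCop nodes ≡ n
    #prod  : countProd nodes ≡ n

open Prograph public

-- PC(n): prographs up to planar isotopy (= equality in the free PRO)
PC : ℕ → Setoid _ _
PC n = record
  { Carrier       = Prograph n
  ; _≈_           = λ p q → EqClosure Swap (nodes p) (nodes q)
  ; isEquivalence = On.isEquivalence nodes (isEquivalence Swap)
  }

data Walk (n : ℕ) : ℕ → ℕ → ℕ → Set where
  end   : Walk n n n n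
  stepX : ∀ {x y z} → Walk n (suc x) y z → Walk n x y z
  stepY : ∀ {x y z} → suc y ≤ x → Walk n x (suc y) z → Walk n x y z
  stepZ : ∀ {x y z} → suc z ≤ y → Walk n x y (suc z) → Walk n x y z

LatticePath : ℕ → Set
LatticePath n = Walk n 0 0 0

catalan3Formula : ℕ → ℕ
catalan3Formula n =
  _/_ (2 * (3 * n) !) (n ! * (suc n) ! * (suc (suc n)) !)
      {{m*n≢0 (n ! * (suc n) !) ((suc (suc n)) !)
        {{m*n≢0 (n !) ((suc n) !) {{n !≢0}} {{suc n !≢0}}}}
        {{suc (suc n) !≢0}}}}

-- Sliding nodes up the strip along the interchange law sorts every layer
-- sequence into a unique normal form, so prographs up to isotopy are the
-- normal layer sequences. Read from bottom to top, a normal sequence is a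
-- lattice path in x ≥ y ≥ z: an x-step places a coproduct, a z-step a product,
-- and a y-step moves the insertion point one wire to the right. Counting paths
-- by their last step gives a recurrence solved by the hook length formula for
-- three-row shapes, which at the shape (n, n, n) is 2 (3n)! / (n! (n+1)! (n+2)!).
module Submission where

open import Defs
open import Data.Empty using (⊥; ⊥-elim)
open import Data.Fin using (Fin)
import Data.Fin as Fin
open import Data.Fin.Properties using (+↔⊎; 0↔⊥)
open import Data.List using (List; []; _∷_)
open import Data.List.Properties using (∷-injectiveʳ)
open import Data.Nat using (ℕ; zero; suc; _+_; _*_; _∸_; _≤_; _<_; _≤?_; _!; NonZero; s≤s; z≤n; _≤′_; ≤′-refl; ≤′-step)
open import Data.Nat.DivMod using (_/_; m*n/n≡m)
open import Data.Nat.Properties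
open import Algebra.Properties.CommutativeSemigroup +-commutativeSemigroup using (xy∙z≈xz∙y)
open import Data.Nat.Tactic.RingSolver using (solve-∀)
open import Data.Product using (Σ; _×_; _,_; proj₁; proj₂)
open import Data.Product.Function.NonDependent.Propositional using (_×-↔_)
open import Data.Sum using (_⊎_; inj₁; inj₂)
open import Data.Sum.Function.Propositional using (_⊎-↔_)
open import Data.Unit using (⊤; tt)
open import Function.Bundles using (Inverse; _↔_; mk↔ₛ′)
open import Function.Construct.Composition using (inverse; _↔-∘_)
open import Function.Construct.Identity using (↔-id)
open import Function.Construct.Symmetry using (↔-sym)
open import Relation.Nullary using (¬_; yes; no; contradiction)
open import Relation.Binary.PropositionalEquality
open import Relation.Binary.Construct.Closure.Equivalence using (EqClosure; gmap; gfold; return; symmetric)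
open import Relation.Binary.Construct.Closure.ReflexiveTransitive using (ε; _◅◅_)

-- The interchange law and normal forms

ins-positive : ∀ k → 0 < ins k
ins-positive cop  = s≤s z≤n
ins-positive prod = s≤s z≤n

outs-positive : ∀ k → 0 < outs k
outs-positive cop  = s≤s z≤n
outs-positive prod = s≤s z≤n

_~_ : List Node → List Node → Set
_~_ = EqClosure Swap

~-cons : ∀ x {l l'} → l ~ l' → (x ∷ l) ~ (x ∷ l')
~-cons x = gmap (x ∷_) λ { (swap xs ys g a h a' p) → swap (x ∷ xs) ys g a h a' p }

-- Two layers acting on disjoint wires can be applied in either order.
width-comm : ∀ w i₁ o₁ i₂ o₂ → i₁ + i₂ ≤ w →
             (w ∸ i₂ + o₂) ∸ i₁ + o₁ ≡ (w ∸ i₁ + o₁) ∸ i₂ + o₂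
width-comm w i₁ o₁ i₂ o₂ i₁+i₂≤w = begin
  (w ∸ i₂ + o₂) ∸ i₁ + o₁             ≡⟨ cong (λ v → (v ∸ i₂ + o₂) ∸ i₁ + o₁) w≡ ⟩
  (t + i₁ + i₂ ∸ i₂ + o₂) ∸ i₁ + o₁   ≡⟨ layers t i₁ o₁ i₂ o₂ ⟩
  t + o₂ + o₁                         ≡⟨ xy∙z≈xz∙y t o₂ o₁ ⟩
  t + o₁ + o₂                         ≡⟨ sym (layers t i₂ o₂ i₁ o₁) ⟩
  (t + i₂ + i₁ ∸ i₁ + o₁) ∸ i₂ + o₂   ≡⟨ cong (λ v → (v ∸ i₁ + o₁) ∸ i₂ + o₂) (trans (xy∙z≈xz∙y t i₂ i₁) (sym w≡)) ⟩
  (w ∸ i₁ + o₁) ∸ i₂ + o₂             ∎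
  where
  open ≡-Reasoning
  t = w ∸ (i₁ + i₂)
  w≡ : w ≡ t + i₁ + i₂
  w≡ = trans (sym (m∸n+n≡m i₁+i₂≤w)) (sym (+-assoc t i₁ i₂))
  layers : ∀ t i₁ o₁ i₂ o₂ → (t + i₁ + i₂ ∸ i₂ + o₂) ∸ i₁ + o₁ ≡ t + o₂ + o₁
  layers t i₁ o₁ i₂ o₂ = begin
    (t + i₁ + i₂ ∸ i₂ + o₂) ∸ i₁ + o₁ ≡⟨ cong (λ v → (v + o₂) ∸ i₁ + o₁) (m+n∸n≡m (t + i₁) i₂) ⟩
    (t + i₁ + o₂) ∸ i₁ + o₁           ≡⟨ cong (λ v → v ∸ i₁ + o₁) (xy∙z≈xz∙y t i₁ o₂) ⟩
    (t + o₂ + i₁) ∸ i₁ + o₁           ≡⟨ cong (_+ o₁) (m+n∸n≡m (t + o₂) i₁) ⟩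
    t + o₂ + o₁                       ∎

-- A node with g inputs at position a, right of a layer with i inputs and o
-- outputs, moves to a ∸ i + o and still fits in the strip.
shift-≤ : ∀ {a i g w} o → i ≤ a → a + g ≤ w → a ∸ i + o + g ≤ w ∸ i + o
shift-≤ {a} {i} {g} {w} o i≤a a+g≤w = begin
  a ∸ i + o + g   ≡⟨ xy∙z≈xz∙y (a ∸ i) o g ⟩
  a ∸ i + g + o   ≡⟨ cong (_+ o) (sym (+-∸-comm g i≤a)) ⟩
  a + g ∸ i + o   ≤⟨ +-monoˡ-≤ o (∸-monoˡ-≤ i a+g≤w) ⟩
  w ∸ i + o       ∎
  where open ≤-Reasoning

-- insert x l slides the bottom node x up past every node of l lying entirely to its left.
insert : Node → List Node → List Node
insert x [] = x ∷ []
insert (g , a) ((h , b) ∷ l) with b + ins h ≤? a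
... | yes _ = (h , b) ∷ insert (g , a ∸ ins h + outs h) l
... | no  _ = (g , a) ∷ (h , b) ∷ l

normalise : List Node → List Node
normalise []      = []
normalise (x ∷ l) = insert x (normalise l)

-- Normal c l: no node of l can be slid below its predecessor, the first one
-- being compared with a node at position c.
Normal : ℕ → List Node → Set
Normal c []            = ⊤
Normal c ((k , b) ∷ l) = c < b + ins k × Normal b l

insert-slide : ∀ g a h b l → b + ins h ≤ a →
               insert (g , a) ((h , b) ∷ l) ≡ (h , b) ∷ insert (g , a ∸ ins h + outs h) l
insert-slide g a h b l p with b + ins h ≤? a
... | yes _ = refl
... | no ¬p = contradiction p ¬p

insert-stop : ∀ g a h b l → ¬ (b + ins h ≤ a) → insert (g , a) ((h , b) ∷ l) ≡ (g , a) ∷ (h , b) ∷ l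
insert-stop g a h b l ¬p with b + ins h ≤? a
... | yes p = contradiction p ¬p
... | no _  = refl

insert-normal : ∀ {c} g a l → c < a + ins g → Normal c l → Normal c (insert (g , a) l)
insert-normal g a [] c<a+g _ = c<a+g , tt
insert-normal g a ((h , b) ∷ l) c<a+g (c<b+h , nl) with b + ins h ≤? a
... | yes b+h≤a = c<b+h , insert-normal g (a ∸ ins h + outs h) l b<a′+g nl
  where
  b<a′+g : b < a ∸ ins h + outs h + ins g
  b<a′+g = <-≤-trans (≤-<-trans (m+n≤o⇒m≤o∸n b b+h≤a) (m<m+n (a ∸ ins h) (outs-positive h)))
                     (m≤m+n _ (ins g))
... | no b+h≰a = c<a+g , ≰⇒> b+h≰a , nl

normalise-normal : ∀ l → Normal 0 (normalise l)
normalise-normal [] = tt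
normalise-normal ((g , a) ∷ l) =
  insert-normal g a (normalise l) (<-≤-trans (ins-positive g) (m≤n+m _ a)) (normalise-normal l)

normalise-normal-id : ∀ {c} l → Normal c l → normalise l ≡ l
normalise-normal-id [] _ = refl
normalise-normal-id ((g , a) ∷ l) (_ , nl) rewrite normalise-normal-id l nl = insert-head l nl
  where
  insert-head : ∀ l → Normal a l → insert (g , a) l ≡ (g , a) ∷ l
  insert-head []            _        = refl
  insert-head ((h , b) ∷ l) (a<b+h , _) = insert-stop g a h b l (<⇒≱ a<b+h)

insert-wf : ∀ {w w'} x l → WF w (x ∷ l) w' → WF w (insert x l) w'
insert-wf x [] wf = wf
insert-wf {w} {w'} (g , a) ((h , b) ∷ l) (step a+g≤w (step b+h≤w' rest)) with b + ins h ≤? a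
... | no _ = step a+g≤w (step b+h≤w' rest)
... | yes b+h≤a =
  step (≤-trans b+h≤a (≤-trans (m≤m+n a (ins g)) a+g≤w))
       (insert-wf (g , a ∸ ins h + outs h) l
         (step (shift-≤ (outs h) h≤a a+g≤w)
               (subst (λ v → WF v l w') (width-comm w (ins h) (outs h) (ins g) (outs g) h+g≤w) rest)))
  where
  h≤a   = m+n≤o⇒n≤o b b+h≤a
  h+g≤w = ≤-trans (+-monoˡ-≤ (ins g) h≤a) a+g≤w

normalise-wf : ∀ {w w'} l → WF w l w' → WF w (normalise l) w'
normalise-wf []      wf          = wf
normalise-wf (x ∷ l) (step p wf) = insert-wf x (normalise l) (step p (normalise-wf l wf))

insert~ : ∀ x l → (x ∷ l) ~ insert x l
insert~ x [] = ε
insert~ (g , a) ((h , b) ∷ l) with b + ins h ≤? a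
... | no _ = ε
... | yes b+h≤a = symmetric Swap (return slide) ◅◅ ~-cons (h , b) (insert~ (g , a′) l)
  where
  a′ = a ∸ ins h + outs h
  a′-back : a′ ∸ outs h + ins h ≡ a
  a′-back = trans (cong (_+ ins h) (m+n∸n≡m (a ∸ ins h) (outs h))) (m∸n+n≡m (m+n≤o⇒n≤o b b+h≤a))
  slide : Swap ((h , b) ∷ (g , a′) ∷ l) ((g , a) ∷ (h , b) ∷ l)
  slide = subst (λ v → Swap ((h , b) ∷ (g , a′) ∷ l) ((g , v) ∷ (h , b) ∷ l)) a′-back
            (swap [] l h b g a′ (+-monoˡ-≤ (outs h) (m+n≤o⇒m≤o∸n b b+h≤a)))

normalise~ : ∀ l → l ~ normalise l
normalise~ []      = ε
normalise~ (x ∷ l) = ~-cons x (normalise~ l) ◅◅ insert~ x (normalise l)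

right-not-left : ∀ {g a a'} h → a + outs g ≤ a' → ¬ (a' + ins h ≤ a)
right-not-left {g} {a} {a'} h a+g≤a' a'+h≤a =
  <⇒≱ (<-≤-trans (m<m+n a (outs-positive g)) a+g≤a') (m+n≤o⇒m≤o a' a'+h≤a)

insert-below : ∀ g a h a' l → a + outs g ≤ a' →
               insert (h , a' ∸ outs g + ins g) ((g , a) ∷ l) ≡ (g , a) ∷ insert (h , a') l
insert-below g a h a' l a+g≤a' = begin
  insert (h , a' ∸ outs g + ins g) ((g , a) ∷ l)
    ≡⟨ insert-slide h _ g a l (+-monoˡ-≤ (ins g) (m+n≤o⇒m≤o∸n a a+g≤a')) ⟩
  (g , a) ∷ insert (h , a' ∸ outs g + ins g ∸ ins g + outs g) l
    ≡⟨ cong (λ v → (g , a) ∷ insert (h , v + outs g) l) (m+n∸n≡m (a' ∸ outs g) (ins g)) ⟩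
  (g , a) ∷ insert (h , a' ∸ outs g + outs g) l
    ≡⟨ cong (λ v → (g , a) ∷ insert (h , v) l) (m∸n+n≡m (m+n≤o⇒n≤o a a+g≤a')) ⟩
  (g , a) ∷ insert (h , a') l ∎
  where open ≡-Reasoning

insert-swap : ∀ g a h a' l → a + outs g ≤ a' →
              insert (g , a) (insert (h , a') l) ≡ insert (h , a' ∸ outs g + ins g) (insert (g , a) l)
insert-swap g a h a' [] a+g≤a' =
  trans (insert-stop g a h a' [] (right-not-left h a+g≤a')) (sym (insert-below g a h a' [] a+g≤a'))
insert-swap g a h a' ((k , c) ∷ l) a+g≤a' with c + ins k ≤? a
... | no k≰a = begin
  insert (g , a) (insert (h , a') ((k , c) ∷ l)) ≡⟨ g-stays ⟩
  (g , a) ∷ insert (h , a') ((k , c) ∷ l)        ≡⟨ sym (insert-below g a h a' _ a+g≤a') ⟩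
  insert (h , a″) ((g , a) ∷ (k , c) ∷ l)        ∎
  where
  open ≡-Reasoning
  a″ = a' ∸ outs g + ins g
  g-stays : insert (g , a) (insert (h , a') ((k , c) ∷ l)) ≡ (g , a) ∷ insert (h , a') ((k , c) ∷ l)
  g-stays with c + ins k ≤? a'
  ... | yes _ = insert-stop g a k c _ k≰a
  ... | no _  = insert-stop g a h a' _ (right-not-left h a+g≤a')
... | yes k≤a = begin
  insert (g , a) (insert (h , a') ((k , c) ∷ l))
    ≡⟨ cong (insert (g , a)) (insert-slide h a' k c l k≤a') ⟩
  insert (g , a) ((k , c) ∷ insert (h , â) l)
    ≡⟨ insert-slide g a k c _ k≤a ⟩
  (k , c) ∷ insert (g , ã) (insert (h , â) l)
    ≡⟨ cong ((k , c) ∷_) (insert-swap g ã h â l (shift-≤ (outs k) (m+n≤o⇒n≤o c k≤a) a+g≤a')) ⟩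
  (k , c) ∷ insert (h , â ∸ outs g + ins g) (insert (g , ã) l)
    ≡⟨ cong (λ v → (k , c) ∷ insert (h , v) (insert (g , ã) l)) widths ⟩
  (k , c) ∷ insert (h , a″ ∸ ins k + outs k) (insert (g , ã) l)
    ≡⟨ sym (insert-slide h a″ k c _ k≤a″) ⟩
  insert (h , a″) ((k , c) ∷ insert (g , ã) l) ∎
  where
  open ≡-Reasoning
  a″ = a' ∸ outs g + ins g
  ã  = a ∸ ins k + outs k
  â  = a' ∸ ins k + outs k
  k≤a' : c + ins k ≤ a'
  k≤a' = ≤-trans k≤a (≤-trans (m≤m+n a (outs g)) a+g≤a')
  k≤a″ : c + ins k ≤ a″
  k≤a″ = ≤-trans k≤a (≤-trans (m+n≤o⇒m≤o∸n a a+g≤a') (m≤m+n _ (ins g)))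
  widths : â ∸ outs g + ins g ≡ a″ ∸ ins k + outs k
  widths = sym (width-comm a' (ins k) (outs k) (outs g) (ins g)
                 (≤-trans (+-monoˡ-≤ (outs g) (m+n≤o⇒n≤o c k≤a)) a+g≤a'))

normalise-swap : ∀ {l l'} → Swap l l' → normalise l ≡ normalise l'
normalise-swap (swap []       ys g a h a' p) = insert-swap g a h a' (normalise ys) p
normalise-swap (swap (x ∷ xs) ys g a h a' p) = cong (insert x) (normalise-swap (swap xs ys g a h a' p))

normalise-cong : ∀ {l l'} → l ~ l' → normalise l ≡ normalise l'
normalise-cong = gfold isEquivalence normalise normalise-swap

countCop-swap : ∀ {l l'} → Swap l l' → countCop l ≡ countCop l'
countCop-swap (swap [] _ cop  _ cop  _ _) = refl
countCop-swap (swap [] _ cop  _ prod _ _) = refl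
countCop-swap (swap [] _ prod _ cop  _ _) = refl
countCop-swap (swap [] _ prod _ prod _ _) = refl
countCop-swap (swap ((cop  , _) ∷ xs) ys g a h a' p) = cong suc (countCop-swap (swap xs ys g a h a' p))
countCop-swap (swap ((prod , _) ∷ xs) ys g a h a' p) = countCop-swap (swap xs ys g a h a' p)

countProd-swap : ∀ {l l'} → Swap l l' → countProd l ≡ countProd l'
countProd-swap (swap [] _ cop  _ cop  _ _) = refl
countProd-swap (swap [] _ cop  _ prod _ _) = refl
countProd-swap (swap [] _ prod _ cop  _ _) = refl
countProd-swap (swap [] _ prod _ prod _ _) = refl
countProd-swap (swap ((cop  , _) ∷ xs) ys g a h a' p) = countProd-swap (swap xs ys g a h a' p)
countProd-swap (swap ((prod , _) ∷ xs) ys g a h a' p) = cong suc (countProd-swap (swap xs ys g a h a' p))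

countCop-cong : ∀ {l l'} → l ~ l' → countCop l ≡ countCop l'
countCop-cong = gfold isEquivalence countCop countCop-swap

countProd-cong : ∀ {l l'} → l ~ l' → countProd l ≡ countProd l'
countProd-cong = gfold isEquivalence countProd countProd-swap

-- Normal forms as lattice walks

width-cop : ∀ {x z} → z ≤ x → suc (x ∸ z) ∸ 1 + 2 ≡ suc (suc x ∸ z)
width-cop {x} {z} z≤x = trans (+-comm (x ∸ z) 2) (cong suc (sym (+-∸-assoc 1 z≤x)))

width-prod : ∀ {x z} → suc z ≤ x → suc (x ∸ z) ∸ 2 + 1 ≡ suc (x ∸ suc z)
width-prod {x} {z} z<x = begin
  x ∸ z ∸ 1 + 1     ≡⟨ cong (λ v → v ∸ 1 + 1) (+-∸-assoc 1 z<x) ⟩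
  x ∸ suc z + 1     ≡⟨ +-comm (x ∸ suc z) 1 ⟩
  suc (x ∸ suc z)   ∎
  where open ≡-Reasoning

Normal-antimono : ∀ {c c'} l → c' ≤ c → Normal c l → Normal c' l
Normal-antimono []      _    _          = tt
Normal-antimono (_ ∷ _) c'≤c (c<b , nl) = ≤-<-trans c'≤c c<b , nl

-- The last input wire of the node emitted by an x- or a z-step is y ∸ z.
cop-reach : ∀ y z → y ∸ z + 1 ≡ suc (y ∸ z)
cop-reach y z = +-comm (y ∸ z) 1

prod-reach : ∀ {y z} → suc z ≤ y → y ∸ suc z + 2 ≡ suc (y ∸ z)
prod-reach {y} {z} z<y = trans (+-comm (y ∸ suc z) 2) (cong suc (sym (+-∸-assoc 1 z<y)))

∸≤⇒≤+ : ∀ {y z c} → z ≤ y → y ∸ z ≤ c → y ≤ c + z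
∸≤⇒≤+ {z = z} {c} z≤y y∸z≤c = subst (_≤ c + z) (m∸n+n≡m z≤y) (+-monoˡ-≤ z y∸z≤c)

wf-[] : ∀ {w w'} → WF w [] w' → w ≡ w'
wf-[] done = refl

module _ {n : ℕ} where

  walkNodes : ∀ {x y z} → Walk n x y z → List Node
  walkNodes end                     = []
  walkNodes {y = y} {z} (stepX w)   = (cop , y ∸ z) ∷ walkNodes w
  walkNodes (stepY _ w)             = walkNodes w
  walkNodes {y = y} {z} (stepZ _ w) = (prod , y ∸ suc z) ∷ walkNodes w

  walkNodes-wf : ∀ {x y z} (w : Walk n x y z) → z ≤ y → y ≤ x → WF (suc (x ∸ z)) (walkNodes w) 1
  walkNodes-wf end _ _ = subst (λ v → WF (suc v) [] 1) (sym (n∸n≡0 n)) done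
  walkNodes-wf {x} {y} {z} (stepX w) z≤y y≤x =
    step (≤-trans (≤-reflexive (cop-reach y z)) (s≤s (∸-monoˡ-≤ z y≤x)))
         (subst (λ v → WF v (walkNodes w) 1) (sym (width-cop (≤-trans z≤y y≤x)))
                (walkNodes-wf w z≤y (≤-trans y≤x (n≤1+n x))))
  walkNodes-wf (stepY y<x w) z≤y _ = walkNodes-wf w (≤-trans z≤y (n≤1+n _)) y<x
  walkNodes-wf {x} {y} {z} (stepZ z<y w) _ y≤x =
    step (≤-trans (≤-reflexive (prod-reach z<y)) (s≤s (∸-monoˡ-≤ z y≤x)))
         (subst (λ v → WF v (walkNodes w) 1) (sym (width-prod (≤-trans z<y y≤x))) (walkNodes-wf w z<y y≤x))

  walkNodes-countCop : ∀ {x y z} (w : Walk n x y z) → countCop (walkNodes w) + x ≡ n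
  walkNodes-countCop end           = refl
  walkNodes-countCop {x} (stepX w) = trans (sym (+-suc _ x)) (walkNodes-countCop w)
  walkNodes-countCop (stepY _ w)   = walkNodes-countCop w
  walkNodes-countCop (stepZ _ w)   = walkNodes-countCop w

  walkNodes-countProd : ∀ {x y z} (w : Walk n x y z) → countProd (walkNodes w) + z ≡ n
  walkNodes-countProd end                 = refl
  walkNodes-countProd (stepX w)           = walkNodes-countProd w
  walkNodes-countProd (stepY _ w)         = walkNodes-countProd w
  walkNodes-countProd {z = z} (stepZ _ w) = trans (sym (+-suc _ z)) (walkNodes-countProd w)

  walkNodes-normal : ∀ {x y z} (w : Walk n x y z) → Normal (y ∸ z) (walkNodes w)
  walkNodes-normal end = tt
  walkNodes-normal {y = y} {z} (stepX w) = ≤-reflexive (sym (cop-reach y z)) , walkNodes-normal w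
  walkNodes-normal {y = y} {z} (stepY _ w) =
    Normal-antimono (walkNodes w) (∸-monoˡ-≤ z (n≤1+n y)) (walkNodes-normal w)
  walkNodes-normal (stepZ z<y w) = ≤-reflexive (sym (prod-reach z<y)) , walkNodes-normal w

  after-stepY : ∀ {x y z k b l} (w : Walk n x (suc y) z) → z ≤ y → walkNodes w ≡ (k , b) ∷ l →
                b + ins k ≢ suc (y ∸ z)
  after-stepY {z = z} {k} {b} w z≤y eq b+k≡y with subst (Normal _) eq (walkNodes-normal w)
  ... | y<b+k , _ = <⇒≱ (subst (_< b + ins k) (+-∸-assoc 1 z≤y) y<b+k) (≤-reflexive b+k≡y)

  walkNodes-injective : ∀ {x y z} (w w' : Walk n x y z) → z ≤ y → walkNodes w ≡ walkNodes w' → w ≡ w'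
  walkNodes-injective end end _ _ = refl
  walkNodes-injective end (stepY y<x _) _ _ = ⊥-elim (<-irrefl refl y<x)
  walkNodes-injective (stepY y<x _) end _ _ = ⊥-elim (<-irrefl refl y<x)
  walkNodes-injective (stepX w) (stepX w') z≤y eq =
    cong stepX (walkNodes-injective w w' z≤y (∷-injectiveʳ eq))
  walkNodes-injective {y = y} {z} (stepX _) (stepY _ w') z≤y eq =
    ⊥-elim (after-stepY w' z≤y (sym eq) (cop-reach y z))
  walkNodes-injective {y = y} {z} (stepY _ w) (stepX _) z≤y eq =
    ⊥-elim (after-stepY w z≤y eq (cop-reach y z))
  walkNodes-injective (stepY y<x w) (stepY y<x' w') z≤y eq =
    cong₂ stepY (≤-irrelevant y<x y<x') (walkNodes-injective w w' (≤-trans z≤y (n≤1+n _)) eq)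
  walkNodes-injective (stepY _ w) (stepZ z<y _) z≤y eq =
    ⊥-elim (after-stepY w z≤y eq (prod-reach z<y))
  walkNodes-injective (stepZ z<y _) (stepY _ w') z≤y eq =
    ⊥-elim (after-stepY w' z≤y (sym eq) (prod-reach z<y))
  walkNodes-injective (stepZ z<y w) (stepZ z<y' w') _ eq =
    cong₂ stepZ (≤-irrelevant z<y z<y') (walkNodes-injective w w' z<y (∷-injectiveʳ eq))

  WalkOf : ℕ → ℕ → ℕ → List Node → Set
  WalkOf x y z l = Σ (Walk n x y z) λ w → walkNodes w ≡ l

  stepsY : ∀ {x y y' z l} → y ≤′ y' → y' ≤ x → WalkOf x y' z l → WalkOf x y z l
  stepsY ≤′-refl           _    wl       = wl
  stepsY (≤′-step y≤′y') y'<x (w , eq) = stepsY y≤′y' (≤-trans (n≤1+n _) y'<x) (stepY y'<x w , eq)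

  walkOfNormal : ∀ {x y z} l → z ≤ y → y ≤ x → WF (suc (x ∸ z)) l 1 → Normal (y ∸ z) l →
                countCop l + x ≡ n → countProd l + z ≡ n → WalkOf x y z l
  walkOfNormal {x} {y} {z} [] z≤y y≤x wf _ x≡n z≡n = end-walk x≡n y≡n z≡n
    where
    x≤z : x ≤ z
    x≤z = m∸n≡0⇒m≤n (suc-injective (wf-[] wf))
    y≡n : y ≡ n
    y≡n = trans (≤-antisym y≤x (≤-trans x≤z z≤y)) x≡n
    end-walk : x ≡ n → y ≡ n → z ≡ n → WalkOf x y z []
    end-walk refl refl refl = end , refl
  walkOfNormal {x} {y} {z} ((cop , b) ∷ l) z≤y y≤x (step b+1≤ wf) (y∸z<b+1 , nl) #cop #prod =
    stepsY (≤⇒≤′ y≤b+z) b+z≤x (stepX w , cong₂ _∷_ (cong (cop ,_) (m+n∸n≡m b z)) w≡l)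
    where
    b+z≤x : b + z ≤ x
    b+z≤x = m≤o∸n⇒m+n≤o b (≤-trans z≤y y≤x) (≤-pred (subst (_≤ suc (x ∸ z)) (+-comm b 1) b+1≤))
    y≤b+z : y ≤ b + z
    y≤b+z = ∸≤⇒≤+ z≤y (≤-pred (subst (y ∸ z <_) (+-comm b 1) y∸z<b+1))
    rest : WalkOf (suc x) (b + z) z l
    rest = walkOfNormal l (m≤n+m z b) (≤-trans b+z≤x (n≤1+n x))
             (subst (λ v → WF v l 1) (width-cop (≤-trans z≤y y≤x)) wf)
             (subst (λ v → Normal v l) (sym (m+n∸n≡m b z)) nl)
             (trans (+-suc _ x) #cop) #prod
    w   = proj₁ rest
    w≡l = proj₂ rest
  walkOfNormal {x} {y} {z} ((prod , b) ∷ l) z≤y y≤x (step b+2≤ wf) (y∸z<b+2 , nl) #cop #prod =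
    stepsY (≤⇒≤′ y≤b+1+z) b+1+z≤x
      (stepZ (m≤n+m (suc z) b) w , cong₂ _∷_ (cong (prod ,_) (m+n∸n≡m b (suc z))) w≡l)
    where
    b+1+z≤x : b + suc z ≤ x
    b+1+z≤x = subst (_≤ x) (+-assoc b 1 z)
                (m≤o∸n⇒m+n≤o (b + 1) (≤-trans z≤y y≤x) (≤-pred (subst (_≤ suc (x ∸ z)) (+-suc b 1) b+2≤)))
    y≤b+1+z : y ≤ b + suc z
    y≤b+1+z = subst (y ≤_) (+-assoc b 1 z) (∸≤⇒≤+ z≤y (≤-pred (subst (y ∸ z <_) (+-suc b 1) y∸z<b+2)))
    rest : WalkOf x (b + suc z) (suc z) l
    rest = walkOfNormal l (m≤n+m (suc z) b) b+1+z≤x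
             (subst (λ v → WF v l 1) (width-prod (≤-trans (m≤n+m (suc z) b) b+1+z≤x)) wf)
             (subst (λ v → Normal v l) (sym (m+n∸n≡m b (suc z))) nl)
             #cop (trans (+-suc _ z) #prod)
    w   = proj₁ rest
    w≡l = proj₂ rest

  prographWalk : (p : Prograph n) → WalkOf 0 0 0 (normalise (nodes p))
  prographWalk (prograph l wf #cop #prod) =
    walkOfNormal (normalise l) z≤n z≤n (normalise-wf l wf) (normalise-normal l)
      (trans (+-identityʳ _) (trans (sym (countCop-cong (normalise~ l))) #cop))
      (trans (+-identityʳ _) (trans (sym (countProd-cong (normalise~ l))) #prod))

  walkPrograph : LatticePath n → Prograph n
  walkPrograph w = prograph (walkNodes w) (walkNodes-wf w z≤n z≤n)
    (trans (sym (+-identityʳ _)) (walkNodes-countCop w))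
    (trans (sym (+-identityʳ _)) (walkNodes-countProd w))

  prographWalk-unique : ∀ p w → normalise (nodes p) ≡ walkNodes w → proj₁ (prographWalk p) ≡ w
  prographWalk-unique p w eq = walkNodes-injective _ _ z≤n (trans (proj₂ (prographWalk p)) eq)

  prograph↔walk : Inverse (PC n) (setoid (LatticePath n))
  prograph↔walk = record
    { to        = λ p → proj₁ (prographWalk p)
    ; from      = walkPrograph
    ; to-cong   = λ {p} {q} p~q →
                    prographWalk-unique p _ (trans (normalise-cong p~q) (sym (proj₂ (prographWalk q))))
    ; from-cong = λ { refl → ε }
    ; inverse   = (λ {w} {p} p~w →
                    prographWalk-unique p w (trans (normalise-cong p~w) (normalise-normal-id _ (walkNodes-normal w))))
                , (λ { {p} refl →
                    subst (_~ nodes p) (sym (proj₂ (prographWalk p))) (symmetric Swap (normalise~ (nodes p))) })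
    }

-- Counting lattice paths

data Path : ℕ → ℕ → ℕ → Set where
  origin  : Path 0 0 0
  extendX : ∀ {x y z} → Path x y z → Path (suc x) y z
  extendY : ∀ {x y z} → suc y ≤ x → Path x y z → Path x (suc y) z
  extendZ : ∀ {x y z} → suc z ≤ y → Path x y z → Path x y (suc z)

Path-chamber : ∀ {x y z} → Path x y z → z ≤ y × y ≤ x
Path-chamber origin          = z≤n , z≤n
Path-chamber (extendX p)     = proj₁ (Path-chamber p) , ≤-trans (proj₂ (Path-chamber p)) (n≤1+n _)
Path-chamber (extendY y<x p) = ≤-trans (proj₁ (Path-chamber p)) (n≤1+n _) , y<x
Path-chamber (extendZ z<y p) = z<y , proj₂ (Path-chamber p)

module _ {n : ℕ} where

  concatPath : ∀ {x y z} → Path x y z → Walk n x y z → Path n n n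
  concatPath p end           = p
  concatPath p (stepX w)     = concatPath (extendX p) w
  concatPath p (stepY y<x w) = concatPath (extendY y<x p) w
  concatPath p (stepZ z<y w) = concatPath (extendZ z<y p) w

  concatWalk : ∀ {x y z} → Path x y z → Walk n x y z → Walk n 0 0 0
  concatWalk origin          w = w
  concatWalk (extendX p)     w = concatWalk p (stepX w)
  concatWalk (extendY y<x p) w = concatWalk p (stepY y<x w)
  concatWalk (extendZ z<y p) w = concatWalk p (stepZ z<y w)

  concatPath-concatWalk : ∀ {x y z} (p : Path x y z) w → concatPath origin (concatWalk p w) ≡ concatPath p w
  concatPath-concatWalk origin          w = refl
  concatPath-concatWalk (extendX p)     w = concatPath-concatWalk p (stepX w)
  concatPath-concatWalk (extendY y<x p) w = concatPath-concatWalk p (stepY y<x w)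
  concatPath-concatWalk (extendZ z<y p) w = concatPath-concatWalk p (stepZ z<y w)

  concatWalk-concatPath : ∀ {x y z} (p : Path x y z) w → concatWalk (concatPath p w) end ≡ concatWalk p w
  concatWalk-concatPath p end           = refl
  concatWalk-concatPath p (stepX w)     = concatWalk-concatPath (extendX p) w
  concatWalk-concatPath p (stepY y<x w) = concatWalk-concatPath (extendY y<x p) w
  concatWalk-concatPath p (stepZ z<y w) = concatWalk-concatPath (extendZ z<y p) w

walk↔path : ∀ n → LatticePath n ↔ Path n n n
walk↔path n = mk↔ₛ′ (concatPath origin) (λ p → concatWalk p end)
  (λ p → concatPath-concatWalk p end) (concatWalk-concatPath origin)

atOrigin : ℕ → ℕ → ℕ → ℕ
atOrigin zero zero zero = 1
atOrigin _    _    _    = 0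

LastX LastY LastZ : ℕ → ℕ → ℕ → Set
LastX zero    y z = ⊥
LastX (suc x) y z = Path x y z
LastY x zero    z = ⊥
LastY x (suc y) z = suc y ≤ x × Path x y z
LastZ x y zero    = ⊥
LastZ x y (suc z) = suc z ≤ y × Path x y z

atOrigin-path : ∀ x y z → Fin (atOrigin x y z) → Path x y z
atOrigin-path zero zero zero Fin.zero = origin

Path-last : ∀ {x y z} → Path x y z ↔ (((Fin (atOrigin x y z) ⊎ LastX x y z) ⊎ LastY x y z) ⊎ LastZ x y z)
Path-last {x} {y} {z} = mk↔ₛ′ last (unlast x y z) (last-unlast x y z) unlast-last
  where
  last : ∀ {x y z} → Path x y z → ((Fin (atOrigin x y z) ⊎ LastX x y z) ⊎ LastY x y z) ⊎ LastZ x y z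
  last origin          = inj₁ (inj₁ (inj₁ Fin.zero))
  last (extendX p)     = inj₁ (inj₁ (inj₂ p))
  last (extendY y<x p) = inj₁ (inj₂ (y<x , p))
  last (extendZ z<y p) = inj₂ (z<y , p)
  unlast : ∀ x y z → ((Fin (atOrigin x y z) ⊎ LastX x y z) ⊎ LastY x y z) ⊎ LastZ x y z → Path x y z
  unlast x y z       (inj₁ (inj₁ (inj₁ i)))     = atOrigin-path x y z i
  unlast zero y z    (inj₁ (inj₁ (inj₂ ())))
  unlast (suc x) y z (inj₁ (inj₁ (inj₂ p)))     = extendX p
  unlast x zero z    (inj₁ (inj₂ ()))
  unlast x (suc y) z (inj₁ (inj₂ (y<x , p)))    = extendY y<x p
  unlast x y zero    (inj₂ ())
  unlast x y (suc z) (inj₂ (z<y , p))           = extendZ z<y p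
  last-unlast : ∀ x y z u → last (unlast x y z u) ≡ u
  last-unlast x y z          (inj₁ (inj₁ (inj₁ i)))        = last-atOrigin x y z i
    where
    last-atOrigin : ∀ x y z i → last (atOrigin-path x y z i) ≡ inj₁ (inj₁ (inj₁ i))
    last-atOrigin zero zero zero Fin.zero = refl
  last-unlast (suc x) y z    (inj₁ (inj₁ (inj₂ p)))        = refl
  last-unlast x (suc y) z    (inj₁ (inj₂ (y<x , p)))       = refl
  last-unlast x y (suc z)    (inj₂ (z<y , p))              = refl
  unlast-last : ∀ {x y z} (p : Path x y z) → unlast x y z (last p) ≡ p
  unlast-last origin          = refl
  unlast-last (extendX p)     = refl
  unlast-last (extendY y<x p) = refl
  unlast-last (extendZ z<y p) = refl

when≤ : ℕ → ℕ → ℕ → ℕ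
when≤ zero    n       k = k
when≤ (suc m) zero    k = 0
when≤ (suc m) (suc n) k = when≤ m n k

≤×Fin↔when≤ : ∀ {m n k} → (m ≤ n × Fin k) ↔ Fin (when≤ m n k)
≤×Fin↔when≤ {m} {n} {k} = mk↔ₛ′ to (from m n) (to-from m n) from-to
  where
  to : ∀ {m n} → m ≤ n × Fin k → Fin (when≤ m n k)
  to (z≤n     , i) = i
  to (s≤s m≤n , i) = to (m≤n , i)
  from : ∀ m n → Fin (when≤ m n k) → m ≤ n × Fin k
  from zero    n       i = z≤n , i
  from (suc m) (suc n) i with from m n i
  ... | m≤n , j = s≤s m≤n , j
  to-from : ∀ m n i → to (from m n i) ≡ i
  to-from zero    n       i = refl
  to-from (suc m) (suc n) i = to-from m n i
  from-to : ∀ {m n} (u : m ≤ n × Fin k) → from m n (to u) ≡ u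
  from-to (z≤n     , i) = refl
  from-to (s≤s m≤n , i) rewrite from-to (m≤n , i) = refl

+↔⊎³ : ∀ {a b c d} → Fin (a + b + c + d) ↔ (((Fin a ⊎ Fin b) ⊎ Fin c) ⊎ Fin d)
+↔⊎³ = ((+↔⊎ ⊎-↔ ↔-id _) ⊎-↔ ↔-id _) ↔-∘ ((+↔⊎ ⊎-↔ ↔-id _) ↔-∘ +↔⊎)

count countX countY countZ : ℕ → ℕ → ℕ → ℕ
count x y z = atOrigin x y z + countX x y z + countY x y z + countZ x y z
countX zero    y z = 0
countX (suc x) y z = count x y z
countY x zero    z = 0
countY x (suc y) z = when≤ (suc y) x (count x y z)
countZ x y zero    = 0
countZ x y (suc z) = when≤ (suc z) y (count x y z)

Path↔count : ∀ x y z → Path x y z ↔ Fin (count x y z)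
LastX↔countX : ∀ x y z → LastX x y z ↔ Fin (countX x y z)
LastY↔countY : ∀ x y z → LastY x y z ↔ Fin (countY x y z)
LastZ↔countZ : ∀ x y z → LastZ x y z ↔ Fin (countZ x y z)

Path↔count x y z =
  ↔-sym +↔⊎³ ↔-∘ ((((↔-id _ ⊎-↔ LastX↔countX x y z) ⊎-↔ LastY↔countY x y z) ⊎-↔ LastZ↔countZ x y z) ↔-∘ Path-last)

LastX↔countX zero    y z = ↔-sym 0↔⊥
LastX↔countX (suc x) y z = Path↔count x y z

LastY↔countY x zero    z = ↔-sym 0↔⊥
LastY↔countY x (suc y) z = ≤×Fin↔when≤ ↔-∘ (↔-id _ ×-↔ Path↔count x y z)

LastZ↔countZ x y zero    = ↔-sym 0↔⊥
LastZ↔countZ x y (suc z) = ≤×Fin↔when≤ ↔-∘ (↔-id _ ×-↔ Path↔count x y z)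

count-empty : ∀ {x y z} → ¬ Path x y z → count x y z ≡ 0
count-empty {x} {y} {z} no-path with count x y z | Inverse.from (Path↔count x y z)
... | zero  | _    = refl
... | suc _ | path = ⊥-elim (no-path (path Fin.zero))

-- The hook length formula

when≤-≤ : ∀ {m n} k → m ≤ n → when≤ m n k ≡ k
when≤-≤ k z≤n       = refl
when≤-≤ k (s≤s m≤n) = when≤-≤ k m≤n

count-y>x : ∀ x y z → suc x ≤ y → count x y z ≡ 0
count-y>x x y z x<y = count-empty λ p → <⇒≱ x<y (proj₂ (Path-chamber p))

count-z>y : ∀ x y z → suc y ≤ z → count x y z ≡ 0
count-z>y x y z y<z = count-empty λ p → <⇒≱ y<z (proj₁ (Path-chamber p))

-- Shape coordinates (x, y, z) = (p + q + c, q + c, c) avoid truncated subtraction.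
countShape : ℕ → ℕ → ℕ → ℕ
countShape c q p = count (p + (q + c)) (q + c) c

size : ℕ → ℕ → ℕ → ℕ
size c q p = p + 2 * q + 3 * c

hookDen : ℕ → ℕ → ℕ → ℕ
hookDen c q p = (suc (suc (p + (q + c)))) ! * ((suc (q + c)) ! * c !)

-- The Vandermonde product of the shifted row lengths x + 2, y + 1, z.
vandermonde : ℕ → ℕ → ℕ
vandermonde q p = (p + 1) * (p + q + 2) * (q + 1)

-- The Vandermonde product of the shape reached by undoing an x-, y- or
-- z-step, times the ratio of hookDen at the two shapes.
weightX weightY weightZ : ℕ → ℕ → ℕ → ℕ
weightX c q p = (p + (q + c) + 2) * (p * (p + q + 1) * (q + 1))
weightY c q p = (q + c + 1) * ((p + 2) * (p + q + 2) * q)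
weightZ c q p = c * ((p + 1) * (p + q + 3) * (q + 2))

weights-sum : ∀ c q p → weightX c q p + weightY c q p + weightZ c q p ≡ size c q p * vandermonde q p
weights-sum = expanded
  where
  expanded : ∀ c q p →
    (p + (q + c) + 2) * (p * (p + q + 1) * (q + 1)) + (q + c + 1) * ((p + 2) * (p + q + 2) * q)
      + c * ((p + 1) * (p + q + 3) * (q + 2)) ≡ (p + 2 * q + 3 * c) * ((p + 1) * (p + q + 2) * (q + 1))
  expanded = solve-∀

countShape-last : ∀ c q p {M} → size c q p ≡ suc M →
  countShape c q p ≡ countX (p + (q + c)) (q + c) c + countY (p + (q + c)) (q + c) c
                       + countZ (p + (q + c)) (q + c) c
countShape-last c q (suc p) _ = refl
countShape-last c (suc q) zero _ = refl
countShape-last (suc c) zero zero _ = refl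
countShape-last zero zero zero ()

countX-diag : ∀ x z → countX x x z ≡ 0
countX-diag zero    z = refl
countX-diag (suc x) z = count-y>x x (suc x) z ≤-refl

countY-diag : ∀ p z → countY (p + z) z z ≡ 0
countY-diag p zero    = refl
countY-diag p (suc z) =
  trans (when≤-≤ _ (m≤n+m (suc z) p)) (count-z>y (p + suc z) z (suc z) ≤-refl)

size-y : ∀ c q p → size c (suc q) p ≡ suc (size c q (suc p))
size-y = expanded
  where
  expanded : ∀ c q p → p + 2 * suc q + 3 * c ≡ suc (suc p + 2 * q + 3 * c)
  expanded = solve-∀

size-z : ∀ c q p → size (suc c) q p ≡ suc (size c (suc q) p)
size-z = expanded
  where
  expanded : ∀ c q p → p + 2 * q + 3 * suc c ≡ suc (p + 2 * suc q + 3 * c)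
  expanded = solve-∀

-- The hook length formula for standard Young tableaux of shape (x, y, z),
-- proved by induction along the lexicographic order on (c, q, p).
hook-length : ∀ c q p → countShape c q p * hookDen c q p ≡ size c q p ! * vandermonde q p
hook-step : ∀ c q p {M} → size c q p ≡ suc M →
            countShape c q p * hookDen c q p ≡ size c q p ! * vandermonde q p
hookX : ∀ c q p {M} → size c q p ≡ suc M →
        countX (p + (q + c)) (q + c) c * hookDen c q p ≡ weightX c q p * M !
hookY : ∀ c q p {M} → size c q p ≡ suc M →
        countY (p + (q + c)) (q + c) c * hookDen c q p ≡ weightY c q p * M !
hookZ : ∀ c q p {M} → size c q p ≡ suc M →
        countZ (p + (q + c)) (q + c) c * hookDen c q p ≡ weightZ c q p * M !

hook-length zero    zero    zero    = refl
hook-length c       q       (suc p) = hook-step c q (suc p) refl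
hook-length c       (suc q) zero    = hook-step c (suc q) zero refl
hook-length (suc c) zero    zero    = hook-step (suc c) zero zero refl

hook-step c q p {M} e = begin
  countShape c q p * D
    ≡⟨ cong (_* D) (countShape-last c q p e) ⟩
  (cX + cY + cZ) * D
    ≡⟨ distrib₃ cX cY cZ D ⟩
  cX * D + cY * D + cZ * D
    ≡⟨ cong₂ _+_ (cong₂ _+_ (hookX c q p e) (hookY c q p e)) (hookZ c q p e) ⟩
  weightX c q p * M ! + weightY c q p * M ! + weightZ c q p * M !
    ≡⟨ sym (distrib₃ (weightX c q p) (weightY c q p) (weightZ c q p) (M !)) ⟩
  (weightX c q p + weightY c q p + weightZ c q p) * M !
    ≡⟨ cong (_* M !) (weights-sum c q p) ⟩
  size c q p * vandermonde q p * M !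
    ≡⟨ cong (λ s → s * vandermonde q p * M !) e ⟩
  suc M * vandermonde q p * M !
    ≡⟨ factorial-step (suc M) (vandermonde q p) (M !) ⟩
  (suc M) ! * vandermonde q p
    ≡⟨ cong (λ s → s ! * vandermonde q p) (sym e) ⟩
  size c q p ! * vandermonde q p ∎
  where
  open ≡-Reasoning
  x  = p + (q + c)
  y  = q + c
  cX = countX x y c
  cY = countY x y c
  cZ = countZ x y c
  D  = hookDen c q p
  distrib₃ : ∀ a b c d → (a + b + c) * d ≡ a * d + b * d + c * d
  distrib₃ = solve-∀
  factorial-step : ∀ m v f → m * v * f ≡ m * f * v
  factorial-step = solve-∀

hookX c q zero {M} _ = begin
  countX (q + c) (q + c) c * hookDen c q 0 ≡⟨ cong (_* hookDen c q 0) (countX-diag (q + c) c) ⟩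
  0                                        ≡⟨ sym (vanishes (q + c) q (M !)) ⟩
  weightX c q 0 * M !                      ∎
  where
  open ≡-Reasoning
  vanishes : ∀ y q f → (y + 2) * (0 * (q + 1) * (q + 1)) * f ≡ 0
  vanishes = solve-∀
hookX c q (suc p) refl = begin
  countShape c q p * ((3 + x) * (2 + x) ! * R)   ≡⟨ reassoc (countShape c q p) (3 + x) ((2 + x) !) R ⟩
  (3 + x) * (countShape c q p * hookDen c q p)  ≡⟨ cong ((3 + x) *_) (hook-length c q p) ⟩
  (3 + x) * (size c q p ! * vandermonde q p)    ≡⟨ polynomial p q c (size c q p !) ⟩
  weightX c q (suc p) * size c q p !            ∎
  where
  open ≡-Reasoning
  x = p + (q + c)
  R = (suc (q + c)) ! * c !
  reassoc : ∀ n a f r → n * (a * f * r) ≡ a * (n * (f * r))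
  reassoc = solve-∀
  polynomial : ∀ p q c f → (3 + (p + (q + c))) * (f * ((p + 1) * (p + q + 2) * (q + 1)))
                          ≡ (suc p + (q + c) + 2) * (suc p * (suc p + q + 1) * (q + 1)) * f
  polynomial = solve-∀

hookY c zero p {M} _ = begin
  countY (p + c) c c * hookDen c 0 p ≡⟨ cong (_* hookDen c 0 p) (countY-diag p c) ⟩
  0                                  ≡⟨ sym (vanishes c p (M !)) ⟩
  weightY c 0 p * M !                ∎
  where
  open ≡-Reasoning
  vanishes : ∀ c p f → (c + 1) * ((p + 2) * (p + 0 + 2) * 0) * f ≡ 0
  vanishes = solve-∀
hookY c (suc q) p e with suc-injective (trans (sym (size-y c q p)) e)
... | refl rewrite +-suc p (q + c) = begin
  when≤ (suc y) (suc (p + y)) (countShape c q (suc p)) * (A * ((2 + y) * F * c !))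
    ≡⟨ cong (_* (A * ((2 + y) * F * c !))) (when≤-≤ _ (s≤s (m≤n+m y p))) ⟩
  countShape c q (suc p) * (A * ((2 + y) * F * c !))
    ≡⟨ reassoc (countShape c q (suc p)) A (2 + y) F (c !) ⟩
  (2 + y) * (countShape c q (suc p) * hookDen c q (suc p))
    ≡⟨ cong ((2 + y) *_) (hook-length c q (suc p)) ⟩
  (2 + y) * (size c q (suc p) ! * vandermonde q (suc p))
    ≡⟨ polynomial p q c (size c q (suc p) !) ⟩
  weightY c (suc q) p * size c q (suc p) ! ∎
  where
  open ≡-Reasoning
  y = q + c
  A = (3 + (p + y)) !
  F = (suc y) !
  reassoc : ∀ n a b f r → n * (a * (b * f * r)) ≡ b * (n * (a * (f * r)))
  reassoc = solve-∀
  polynomial : ∀ p q c f → (2 + (q + c)) * (f * ((suc p + 1) * (suc p + q + 2) * (q + 1)))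
                          ≡ (suc q + c + 1) * ((p + 2) * (p + suc q + 2) * suc q) * f
  polynomial = solve-∀

hookZ zero    q p _ = refl
hookZ (suc c) q p e with suc-injective (trans (sym (size-z c q p)) e)
... | refl rewrite +-suc q c = begin
  when≤ (suc c) (suc y) (countShape c (suc q) p) * (A * (F * (suc c * c !)))
    ≡⟨ cong (_* (A * (F * (suc c * c !)))) (when≤-≤ _ (s≤s (m≤n+m c q))) ⟩
  countShape c (suc q) p * (A * (F * (suc c * c !)))
    ≡⟨ reassoc (countShape c (suc q) p) A F (suc c) (c !) ⟩
  suc c * (countShape c (suc q) p * hookDen c (suc q) p)
    ≡⟨ cong (suc c *_) (hook-length c (suc q) p) ⟩
  suc c * (size c (suc q) p ! * vandermonde (suc q) p)
    ≡⟨ polynomial p q c (size c (suc q) p !) ⟩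
  weightZ (suc c) q p * size c (suc q) p ! ∎
  where
  open ≡-Reasoning
  y = q + c
  A = (2 + (p + suc y)) !
  F = (2 + y) !
  reassoc : ∀ n a f s r → n * (a * (f * (s * r))) ≡ s * (n * (a * (f * r)))
  reassoc = solve-∀
  polynomial : ∀ p q c f → suc c * (f * ((p + 1) * (p + suc q + 2) * (suc q + 1)))
                          ≡ suc c * ((p + 1) * (p + q + 3) * (q + 2)) * f
  polynomial = solve-∀

count≡catalan3Formula : ∀ n → count n n n ≡ catalan3Formula n
count≡catalan3Formula n = sym (begin
  2 * (3 * n) ! / D              ≡⟨ cong (_/ D) numerator ⟩
  count n n n * D / D            ≡⟨ m*n/n≡m (count n n n) D ⟩
  count n n n                    ∎)
  where
  open ≡-Reasoning
  D = n ! * (suc n) ! * (suc (suc n)) !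
  instance
    D≢0 : NonZero D
    D≢0 = m*n≢0 (n ! * (suc n) !) ((suc (suc n)) !) {{n !* suc n !≢0}} {{suc (suc n) !≢0}}
  reorder : ∀ x a b c → x * (a * (b * c)) ≡ x * (c * b * a)
  reorder = solve-∀
  numerator : 2 * (3 * n) ! ≡ count n n n * D
  numerator = trans (*-comm 2 ((3 * n) !))
                (trans (sym (hook-length n 0 0)) (reorder (count n n n) ((suc (suc n)) !) ((suc n) !) (n !)))

mainTheorem1 : (n : ℕ) →
    Inverse (PC n) (setoid (LatticePath n)) × Inverse (PC n) (setoid (Fin (catalan3Formula n)))
mainTheorem1 n = prograph↔walk , inverse prograph↔walk walk↔fin
  where
  walk↔fin : LatticePath n ↔ Fin (catalan3Formula n)
  walk↔fin = subst (λ m → LatticePath n ↔ Fin m) (count≡catalan3Formula n) (Path↔count n n n ↔-∘ walk↔path n)
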